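{- In the following multi-structural games on linear orders, Spoiler has a winning strategy with the stated pattern: (1) $\mathrm{MSL}_{\forall,1}(1)$ with pattern $(\forall)$; (2) $\mathrm{MSL}_{\exists,2}(1)$ with pattern $(\exists,\forall)$; (3) $\mathrm{MSL}_{\forall,2}(2)$ with pattern $(\forall,\forall)$; (4) $\mathrm{MSL}_{\forall,3}(2)$ with pattern $(\forall,\exists,\forall)$.
   Context: Let $\tau_{\mathsf{ord}} = \langle <; \mathsf{min}, \mathsf{max}\rangle$. For $\ell\ge1$, $L_\ell$ is the linear order on $\ell+1$ elements with $\mathsf{min},\mathsf{max}$ its first and last elements; $L_{\le\ell}=\{L_1,\dots,L_\ell\}$, $L_{>\ell}=\{L_m:m>\ell\}$. A board is a structure with pebbles of distinct colors placed on elements; two boards form a matching pair if the map sending each pebbled element to the correspondingly colored pebbled element and $\mathsf{min}\mapsto\mathsf{min}$, $\mathsf{max}\mapsto\mathsf{max}$ is a well-defined isomorphism of induced substructures. In the $r$-round multi-structural game on $(\mathcal{A},\mathcal{B})$, in each round Spoiler chooses a side and an unused color and places a pebble of that color on an element of every board on that side; Duplicator may make any number of copies of each board on the other side and places a pebble of that color on an element of each. Duplicator wins if after round $r$ some board on side $\mathcal{A}$ and some board on side $\mathcal{B}$ form a matching pair; otherwise Spoiler wins. A strategy has pattern $(Q_1,\dots,Q_r)$ if Spoiler plays on side $\mathcal{A}$ in round $i$ when $Q_i=\exists$ and on side $\mathcal{B}$ when $Q_i=\forall$. $\mathrm{MSL}_{Q,r}(\ell)$ denotes the $r$-round multi-structural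 game on $(L_{\le\ell}, L_{>\ell})$ in which Spoiler's first move must be on side $L_{\le \ell}$ if $Q=\exists$ and on side $L_{>\ell}$ if $Q=\forall$. -}

module Defs where

open import Data.Nat using (ℕ; zero; suc; _≤_; _<_)
open import Data.Fin as Fin using (Fin; fromℕ) renaming (zero to fzero; suc to fsuc)
open import Data.Vec using (Vec; []; _∷_; lookup)
open import Data.Product using (Σ; ∃; _×_; _,_; proj₁; proj₂)
open import Data.List using (List; []; _∷_)
open import Relation.Binary.PropositionalEquality using (_≡_)
open import Relation.Nullary using (¬_)
open import Function.Bundles using (_⇔_)
open import Level using (Level; Lift)

-- L_m : the linear order on m+1 elements, carrier Fin (suc m), order Fin._<_,
-- min = 0, max = m.
Elem : ℕ → Set
Elem m = Fin (suc m)

minL : (m : ℕ) → Elem m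
minL m = fzero

maxL : (m : ℕ) → Elem m
maxL m = fromℕ m

-- A board with k pebbles: a structure L_m together with the positions of
-- the k pebbles (pebble colours = positions in the vector).
Board : ℕ → Set
Board k = Σ ℕ λ m → Vec (Elem m) k

point : ∀ {k} (b : Board k) → Fin (suc (suc k)) → Elem (proj₁ b)
point (m , v) fzero = minL m
point (m , v) (fsuc fzero) = maxL m
point (m , v) (fsuc (fsuc i)) = lookup v i

-- Matching pair: the map sending each pebbled element to the equally
-- coloured pebbled element, min ↦ min, max ↦ max, is a well-defined
-- isomorphism of the induced substructures (w.r.t. equality and <).
Matching : ∀ {k} → Board k → Board k → Set
Matching {k} a b = ∀ (s t : Fin (suc (suc k))) →
  ((point a s ≡ point a t) ⇔ (point b s ≡ point b t)) ×
  ((point a s Fin.< point a t) ⇔ (point b s Fin.< point b t))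

-- A side of the game: an indexed family of boards (copies allowed).
Side : ℕ → Set₁
Side k = Σ Set λ I → (I → Board k)

place : ∀ {k} (b : Board k) → Elem (proj₁ b) → Board (suc k)
place (m , v) x = (m , x ∷ v)

SpoilerMove : ∀ {k} → Side k → Set
SpoilerMove (I , bs) = (i : I) → Elem (proj₁ (bs i))

applySpoiler : ∀ {k} (S : Side k) → SpoilerMove S → Side (suc k)
applySpoiler (I , bs) f = (I , λ i → place (bs i) (f i))

-- Duplicator's move on a side: any number (≥ 1) of copies of each board,
-- each copy receiving a pebble.  Copies are indexed by J with parent map
-- p : J → I, which must be surjective.
record DuplicatorMove {k} (S : Side k) : Set₁ where
  field
    J      : Set
    parent : J → proj₁ S
    onto   : ∀ i → ∃ λ j → parent j ≡ i
    choice : (j : J) → Elem (proj₁ (proj₂ S (parent j)))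

applyDuplicator : ∀ {k} (S : Side k) → DuplicatorMove S → Side (suc k)
applyDuplicator (I , bs) d = (J , λ j → place (bs (parent j)) (choice j))
  where open DuplicatorMove d

data Quant : Set where
  ∃Q ∀Q : Quant

SpoilerWins : ∀ {k} → List Quant → Side k → Side k → Set₁
SpoilerWins [] (I , as) (J , bs) = Lift (Level.suc Level.zero) (¬ (Σ I λ i → Σ J λ j → Matching (as i) (bs j)))
SpoilerWins (∃Q ∷ qs) A B =
  Σ (SpoilerMove A) λ f → (d : DuplicatorMove B) →
    SpoilerWins qs (applySpoiler A f) (applyDuplicator B d)
SpoilerWins (∀Q ∷ qs) A B =
  Σ (SpoilerMove B) λ f → (d : DuplicatorMove A) →
    SpoilerWins qs (applyDuplicator A d) (applySpoiler B f)

Lle : ℕ → Side 0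
Lle ℓ = (Σ ℕ λ m → 1 ≤ m × m ≤ ℓ) , λ x → (proj₁ x , [])

Lgt : ℕ → Side 0
Lgt ℓ = (Σ ℕ λ m → ℓ < m) , λ x → (proj₁ x , [])

-- Spoiler has a winning strategy with pattern qs in MSL_{Q,r}(ℓ), where
-- r = length qs and Q = head of qs (forcing the first move's side).
SpoilerWinsMSL : ℕ → List Quant → Set₁
SpoilerWinsMSL ℓ qs = SpoilerWins qs (Lle ℓ) (Lgt ℓ)

{-# OPTIONS --safe #-}
-- Spoiler marks, on every large board L_m (m > ℓ), the elements 1, …, ℓ.
-- Together with min and max they form a strictly increasing chain of ℓ + 2
-- distinguished points, and a matching pair transports this chain to the
-- opposite board; but a board L_m with m ≤ ℓ has only ℓ + 1 elements.
module Submission where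

open import Defs
open import Data.List using (List; []; _∷_; length)
open import Data.List.Properties using (length-map)
open import Data.List.Relation.Unary.Linked as Linked using (Linked; []; [-]; _∷_)
open import Data.List.Relation.Unary.Linked.Properties using (map⁺)
open import Data.Product using (_×_; _,_; proj₁; proj₂)
open import Data.Nat using (suc; _+_; _≤_; _<_; z≤n; s≤s; z<s)
open import Data.Nat.Properties
  using (≤-refl; ≤-trans; <-trans; +-suc; +-identityʳ; +-monoˡ-≤; m≤n+m; m<n⇒m<1+n; n<1+n; <⇒≱; module ≤-Reasoning)
open import Data.Fin as Fin using (Fin; toℕ; fromℕ<; #_) renaming (zero to fzero; suc to fsuc)
open import Data.Fin.Properties using (toℕ<n; toℕ-fromℕ; toℕ-fromℕ<)
open import Function using (_on_)
open import Function.Bundles using (Equivalence)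
open import Relation.Binary.PropositionalEquality using (_≡_; refl; sym; subst; subst₂)
open import Relation.Nullary using (¬_)
open import Level using (lift)

open DuplicatorMove using (parent)

head+length< : ∀ {n x} {xs : List (Fin n)} → Linked Fin._<_ (x ∷ xs) → toℕ x + length xs < n
head+length< {x = x} [-] = subst (_< _) (sym (+-identityʳ (toℕ x))) (toℕ<n x)
head+length< {n} {x} (_∷_ {y = y} {xs = ys} x<y y∷ys) = begin-strict
  toℕ x + suc (length ys)  ≡⟨ +-suc (toℕ x) (length ys) ⟩
  suc (toℕ x) + length ys  ≤⟨ +-monoˡ-≤ (length ys) x<y ⟩
  toℕ y + length ys        <⟨ head+length< y∷ys ⟩
  n                        ∎
  where open ≤-Reasoning

Linked-<⇒length≤ : ∀ {n} {xs : List (Fin n)} → Linked Fin._<_ xs → length xs ≤ n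
Linked-<⇒length≤ [] = z≤n
Linked-<⇒length≤ {xs = x ∷ xs} x∷xs = ≤-trans (s≤s (m≤n+m (length xs) (toℕ x))) (head+length< x∷xs)

minPoint maxPoint : ∀ {k} → Fin (suc (suc k))
minPoint = fzero
maxPoint = fsuc fzero

-- Each new pebble is consed onto the board, so pebblePoint (# 0) is the latest one.
pebblePoint : ∀ {k} → Fin k → Fin (suc (suc k))
pebblePoint i = fsuc (fsuc i)

Chain : ∀ {k} → Board k → List (Fin (suc (suc k))) → Set
Chain b = Linked (Fin._<_ on point b)

Chain-length≤ : ∀ {k} (b : Board k) {ss} → Chain b ss → length ss ≤ suc (proj₁ b)
Chain-length≤ b {ss} c = subst (_≤ _) (length-map (point b) ss) (Linked-<⇒length≤ (map⁺ c))

Matching⇒Chain : ∀ {k} {a b : Board k} {ss} → Matching a b → Chain b ss → Chain a ss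
Matching⇒Chain M = Linked.map λ {s} {t} → Equivalence.from (proj₂ (M s t))

Chain⇒¬Matching : ∀ {k} {a b : Board k} {ss} → suc (proj₁ a) < length ss → Chain b ss → ¬ Matching a b
Chain⇒¬Matching {a = a} short c M = <⇒≱ short (Chain-length≤ a (Matching⇒Chain M c))

spoilerWins-chain : ∀ {k ℓ} {A B : Side k} (ss : List (Fin (suc (suc k)))) → suc (suc ℓ) ≤ length ss →
  (∀ i → proj₁ (proj₂ A i) ≤ ℓ) → (∀ j → Chain (proj₂ B j) ss) → SpoilerWins [] A B
spoilerWins-chain ss long small chain =
  lift λ (i , j , M) → Chain⇒¬Matching (≤-trans (s≤s (s≤s (small i))) long) (chain j) M

Lle-bounded : ∀ {ℓ} (x : proj₁ (Lle ℓ)) → proj₁ x ≤ ℓ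
Lle-bounded (_ , _ , m≤ℓ) = m≤ℓ

at : ∀ {j m} → j < m → Elem m
at j<m = fromℕ< (m<n⇒m<1+n j<m)

toℕ-at : ∀ {j m} (j<m : j < m) → toℕ (at j<m) ≡ j
toℕ-at j<m = toℕ-fromℕ< (m<n⇒m<1+n j<m)

min<at : ∀ {j m} (j<m : j < m) → 0 < j → minL m Fin.< at j<m
min<at j<m = subst (0 <_) (sym (toℕ-at j<m))

at<at : ∀ {i j m} (i<m : i < m) (j<m : j < m) → i < j → at i<m Fin.< at j<m
at<at i<m j<m = subst₂ _<_ (sym (toℕ-at i<m)) (sym (toℕ-at j<m))

at<max : ∀ {j m} (j<m : j < m) → at j<m Fin.< maxL m
at<max {m = m} j<m = subst₂ _<_ (sym (toℕ-at j<m)) (sym (toℕ-fromℕ m)) j<m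

2<⇒1< : ∀ {m} → 2 < m → 1 < m
2<⇒1< = <-trans (n<1+n 1)

spoilerWins-∀ : SpoilerWinsMSL 1 (∀Q ∷ [])
spoilerWins-∀ =
  (λ (_ , 1<m) → at 1<m) , λ d →
  spoilerWins-chain (minPoint ∷ pebblePoint (# 0) ∷ maxPoint ∷ []) ≤-refl
    (λ i → Lle-bounded (parent d i))
    (λ (_ , 1<m) → min<at 1<m z<s ∷ at<max 1<m ∷ [-])

spoilerWins-∃∀ : SpoilerWinsMSL 1 (∃Q ∷ ∀Q ∷ [])
spoilerWins-∃∀ =
  (λ _ → fzero) , λ d →
  (λ j → at (proj₂ (parent d j))) , λ d′ →
  spoilerWins-chain (minPoint ∷ pebblePoint (# 0) ∷ maxPoint ∷ []) ≤-refl
    (λ i → Lle-bounded (parent d′ i))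
    (λ j → let 1<m = proj₂ (parent d j) in min<at 1<m z<s ∷ at<max 1<m ∷ [-])

spoilerWins-∀∀ : SpoilerWinsMSL 2 (∀Q ∷ ∀Q ∷ [])
spoilerWins-∀∀ =
  (λ (_ , 2<m) → at (2<⇒1< 2<m)) , λ d →
  (λ (_ , 2<m) → at 2<m) , λ d′ →
  spoilerWins-chain (minPoint ∷ pebblePoint (# 1) ∷ pebblePoint (# 0) ∷ maxPoint ∷ []) ≤-refl
    (λ i → Lle-bounded (parent d (parent d′ i)))
    (λ (_ , 2<m) → min<at (2<⇒1< 2<m) z<s ∷ at<at (2<⇒1< 2<m) 2<m (n<1+n 1) ∷ at<max 2<m ∷ [-])

spoilerWins-∀∃∀ : SpoilerWinsMSL 2 (∀Q ∷ ∃Q ∷ ∀Q ∷ [])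
spoilerWins-∀∃∀ =
  (λ (_ , 2<m) → at (2<⇒1< 2<m)) , λ d →
  (λ _ → fzero) , λ d′ →
  (λ j → at (proj₂ (parent d′ j))) , λ d″ →
  spoilerWins-chain (minPoint ∷ pebblePoint (# 2) ∷ pebblePoint (# 0) ∷ maxPoint ∷ []) ≤-refl
    (λ i → Lle-bounded (parent d (parent d″ i)))
    (λ j → let 2<m = proj₂ (parent d′ j) in
      min<at (2<⇒1< 2<m) z<s ∷ at<at (2<⇒1< 2<m) 2<m (n<1+n 1) ∷ at<max 2<m ∷ [-])

propositionA1 : SpoilerWinsMSL 1 (∀Q ∷ [])
    × SpoilerWinsMSL 1 (∃Q ∷ ∀Q ∷ [])
    × SpoilerWinsMSL 2 (∀Q ∷ ∀Q ∷ [])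
    × SpoilerWinsMSL 2 (∀Q ∷ ∃Q ∷ ∀Q ∷ [])
propositionA1 = spoilerWins-∀ , spoilerWins-∃∀ , spoilerWins-∀∀ , spoilerWins-∀∃∀
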